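{- Let $q$ be a prime power, $n\ge 1$, $\alpha$ a generator of the multiplicative group $\mathbb{F}_{q^n}^\times$, $\mathcal{B}$ an ordered basis of $\mathbb{F}_{q^n}$ over $\mathbb{F}_q$, and $\mathbf{x}\in\mathbb{F}_q^n$ a nonzero vector. For each integer $j$ let $\Lambda_j=\mathbf{x}^\intercal f_{\mathcal{B}}(\alpha^j)\in\mathbb{F}_q$ and $\Phi(j)=(\Lambda_j,\Lambda_{j+1},\ldots,\Lambda_{j+n-1})^\intercal\in\mathbb{F}_q^n$. Then the map $\Psi:\mathbb{F}_{q^n}\to\mathbb{F}_q^n$ defined by $\Psi(0)=0$ and $\Psi(\alpha^j)=\Phi(j)$ is (well defined and) an isomorphism from the additive group of $\mathbb{F}_{q^n}$ to the additive group $\mathbb{F}_q^n$.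
   Context: For an ordered basis $\mathcal{B}=(b_1,\ldots,b_n)$ of $\mathbb{F}_{q^n}$ over $\mathbb{F}_q$ and $\gamma\in\mathbb{F}_{q^n}$, $f_{\mathcal{B}}(\gamma)\in\mathbb{F}_q^n$ denotes the column vector whose $j$-th coordinate is the coefficient of $b_j$ in the expansion of $\gamma$ in the basis $\mathcal{B}$. Since $\alpha^{q^n-1}=1$, the sequence $\Lambda_j$ is periodic in $j$ with period dividing $q^n-1$. -}

module Defs where

open import Level using (0ℓ)
open import Data.Nat using (ℕ; zero; suc; _+_)
open import Data.Fin using (Fin; toℕ)
open import Data.Vec using (Vec; tabulate; lookup)
open import Data.Product using (Σ; ∃; _×_; proj₁; _,_)
open import Relation.Binary.PropositionalEquality using (_≡_; refl)
open import Relation.Nullary using (¬_)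
open import Algebra.Structures using (IsCommutativeRing)
open import Function.Definitions using (Bijective)

record Field : Set₁ where
  infixl 6 _+F_
  infixl 7 _*F_
  field
    Carrier : Set
    _+F_ _*F_ : Carrier → Carrier → Carrier
    -F_ : Carrier → Carrier
    0F 1F : Carrier
    isCommutativeRing : IsCommutativeRing _≡_ _+F_ _*F_ -F_ 0F 1F
    0≢1 : ¬ (0F ≡ 1F)
    inverse : ∀ x → ¬ (x ≡ 0F) → ∃ λ y → x *F y ≡ 1F

  pow : Carrier → ℕ → Carrier
  pow x zero = 1F
  pow x (suc j) = x *F pow x j

  sumF : (n : ℕ) → (Fin n → Carrier) → Carrier
  sumF zero f = 0F
  sumF (suc n) f = f Fin.zero +F sumF n (λ i → f (Fin.suc i))
    where import Data.Fin as Fin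

open Field

record Extension (K L : Field) : Set where
  field
    ι : Carrier K → Carrier L
    ι-+ : ∀ a b → ι (_+F_ K a b) ≡ _+F_ L (ι a) (ι b)
    ι-* : ∀ a b → ι (_*F_ K a b) ≡ _*F_ L (ι a) (ι b)
    ι-1 : ι (1F K) ≡ 1F L

linComb : {K L : Field} → Extension K L → (n : ℕ) → (Fin n → Carrier L)
        → (Fin n → Carrier K) → Carrier L
linComb {K} {L} E n b c = sumF L n (λ j → _*F_ L (Extension.ι E (c j)) (b j))

IsBasis : {K L : Field} → Extension K L → (n : ℕ) → (Fin n → Carrier L) → Set
IsBasis E n b = Bijective _≡_ _≡_ (linComb E n b)

coords : {K L : Field} (E : Extension K L) (n : ℕ) (b : Fin n → Carrier L)
       → IsBasis E n b → Carrier L → (Fin n → Carrier K)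
coords E n b (_ , surj) γ = proj₁ (surj γ)

IsPrimitive : (L : Field) → Carrier L → Set
IsPrimitive L α = ¬ (α ≡ 0F L) × (∀ γ → ¬ (γ ≡ 0F L) → ∃ λ (j : ℕ) → pow L α j ≡ γ)

Λ : {K L : Field} (E : Extension K L) (n : ℕ) (b : Fin n → Carrier L)
  → IsBasis E n b → Carrier L → Vec (Carrier K) n → ℕ → Carrier K
Λ {K} {L} E n b B α x j =
  sumF K n (λ i → _*F_ K (lookup x i) (coords E n b B (pow L α j) i))

Φ : {K L : Field} (E : Extension K L) (n : ℕ) (b : Fin n → Carrier L)
  → IsBasis E n b → Carrier L → Vec (Carrier K) n → ℕ → Vec (Carrier K) n
Φ E n b B α x j = tabulate (λ i → Λ E n b B α x (j + toℕ i))

{-# OPTIONS --safe #-}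
-- Ψ γ = (T γ, T (α γ), …, T (α^(n-1) γ)) with T = xᵀ f_B (functional x), so Ψ is additive
-- and Ψ (α^j) = Φ j. Counting shows that 1, α, …, αⁿ are K-linearly dependent, hence some α^m
-- with m ≤ n is a combination of lower powers and every power of α lies in span (1, …, α^(m-1)).
-- If Ψ γ = 0 with γ ≠ 0, then T vanishes on every α^k γ, i.e. on all of L since α generates L^×,
-- which forces x = 0. So Ψ is injective, hence bijective as L and Kⁿ both have q^n elements.
module Submission where

open import Defs
open import Data.Nat using (ℕ; _≤_)
open import Data.Fin using (Fin)
open import Data.Vec using (Vec; replicate; zipWith)
open import Data.Product using (Σ; _×_)
open import Relation.Binary.PropositionalEquality using (_≡_)
open import Relation.Nullary using (¬_)
open import Function.Bundles using (_↔_)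
open import Function.Definitions using (Bijective)

open import Level using (0ℓ)
open import Algebra.Bundles using (CommutativeRing)
open import Data.Nat using (zero; suc; _+_; _<_; _^_; z≤n; s≤s; s≤s⁻¹; _≤′_; ≤′-refl; ≤′-step)
open import Data.Nat.Properties
  using (≤-refl; n<1+n; <⇒≤; <-≤-trans; m<n⇒m<1+n; m≤n⇒m<n∨m≡n; ≤⇒≤′; 1+n≰n; ^-monoʳ-<)
open import Data.Fin using (zero; suc; toℕ; fromℕ<; punchOut)
open import Data.Fin.Properties using (any?; pigeonhole; punchOut-injective; injective⇒≤; <⇒≢; toℕ-fromℕ<; *↔×)
  renaming (_≟_ to _≟ᶠ_)
open import Data.Vec using ([]; _∷_; tabulate; lookup; map; uncons)
open import Data.Vec.Properties using (lookup∘tabulate; tabulate∘lookup; tabulate-cong; lookup-replicate)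
import Data.Vec.Functional as Vector
open import Data.Product using (∃; ∃₂; _,_; proj₁; proj₂; uncurry; map₁; map₂)
open import Data.Product.Function.NonDependent.Propositional using (_×-↔_)
open import Data.Sum using (inj₁; inj₂)
open import Function using (_∘_)
open import Function.Bundles using (Injection; mk↔ₛ′; module Inverse)
open import Function.Definitions using (Injective; Surjective)
open import Function.Properties.Inverse using (↔-trans; ↔-sym; ↔⇒↣)
open import Relation.Binary.Definitions using (DecidableEquality)
open import Relation.Binary.PropositionalEquality
  using (_≢_; _≗_; refl; sym; trans; cong; cong₂; subst; module ≡-Reasoning)
open import Relation.Nullary using (yes; no; contradiction)
open import Relation.Nullary.Decidable using (via-injection)

private
  variable
    A B : Set

tabulate-const : ∀ n (a : A) → tabulate {n = n} (λ _ → a) ≡ replicate n a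
tabulate-const zero    a = refl
tabulate-const (suc n) a = cong (a ∷_) (tabulate-const n a)

zipWith-tabulate : ∀ {n} (_∙_ : A → A → A) (f g : Fin n → A) →
                   zipWith _∙_ (tabulate f) (tabulate g) ≡ tabulate (λ i → f i ∙ g i)
zipWith-tabulate {n = zero}  _∙_ f g = refl
zipWith-tabulate {n = suc n} _∙_ f g = cong (f zero ∙ g zero ∷_) (zipWith-tabulate _∙_ (f ∘ suc) (g ∘ suc))

private
  to-injective : ∀ {N} (e : A ↔ Fin N) → Injective _≡_ _≡_ (Inverse.to e)
  to-injective e = Injection.injective (↔⇒↣ e)

  from-injective : ∀ {N} (e : A ↔ Fin N) → Injective _≡_ _≡_ (Inverse.from e)
  from-injective e = Injection.injective (↔⇒↣ (↔-sym e))

fin-injective⇒surjective : ∀ {N} (f : Fin N → Fin N) → Injective _≡_ _≡_ f → ∀ y → ∃ λ x → f x ≡ y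
fin-injective⇒surjective {suc N} f f-inj y with any? (λ x → f x ≟ᶠ y)
... | yes hit = hit
... | no miss = contradiction (injective⇒≤ punched-injective) 1+n≰n
  where
  y≢f : ∀ x → y ≢ f x
  y≢f x y≡fx = miss (x , sym y≡fx)

  punched-injective : Injective _≡_ _≡_ (λ x → punchOut (y≢f x))
  punched-injective {x} {x′} = f-inj ∘ punchOut-injective (y≢f x) (y≢f x′)

↔Fin-injective⇒surjective : ∀ {N} → A ↔ Fin N → B ↔ Fin N →
                            (f : A → B) → Injective _≡_ _≡_ f → Surjective _≡_ _≡_ f
↔Fin-injective⇒surjective eA eB f f-inj y
  with x , hit ← fin-injective⇒surjective (Inverse.to eB ∘ f ∘ Inverse.from eA)
                   (from-injective eA ∘ f-inj ∘ to-injective eB) (Inverse.to eB y)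
  = Inverse.from eA x , λ { refl → to-injective eB hit }

↔Fin-pigeonhole : ∀ {M N} → A ↔ Fin M → B ↔ Fin N → N < M →
                  (f : A → B) → ∃₂ λ a a′ → a ≢ a′ × f a ≡ f a′
↔Fin-pigeonhole eA eB N<M f
  with i , j , i<j , hit ← pigeonhole N<M (Inverse.to eB ∘ f ∘ Inverse.from eA)
  = Inverse.from eA i , Inverse.from eA j , <⇒≢ i<j ∘ from-injective eA , to-injective eB hit

↔Fin⇒≟ : ∀ {N} → A ↔ Fin N → DecidableEquality A
↔Fin⇒≟ e = via-injection (↔⇒↣ e) _≟ᶠ_

↔Fin-distinct⇒1< : ∀ {N} → A ↔ Fin N → {a a′ : A} → a ≢ a′ → 1 < N
↔Fin-distinct⇒1< e a≢a′ = fin-distinct⇒1< (a≢a′ ∘ to-injective e)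
  where
  fin-distinct⇒1< : ∀ {N} {i j : Fin N} → i ≢ j → 1 < N
  fin-distinct⇒1< {suc zero}    {zero} {zero} i≢j = contradiction refl i≢j
  fin-distinct⇒1< {suc (suc N)} _                 = s≤s (s≤s z≤n)

vec↔fin^ : ∀ {q} → A ↔ Fin q → ∀ n → Vec A n ↔ Fin (q ^ n)
vec↔fin^ e zero    = mk↔ₛ′ (λ _ → zero) (λ _ → []) (λ { zero → refl }) (λ { [] → refl })
vec↔fin^ e (suc n) = ↔-trans uncons↔ (↔-trans (e ×-↔ vec↔fin^ e n) (↔-sym *↔×))
  where
  uncons↔ : Vec A (suc n) ↔ (A × Vec A n)
  uncons↔ = mk↔ₛ′ uncons (uncurry _∷_) (λ _ → refl) (λ { (a ∷ v) → refl })

module FieldProperties (F : Field) where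

  open Field F public
  open ≡-Reasoning

  commutativeRing : CommutativeRing 0ℓ 0ℓ
  commutativeRing = record { isCommutativeRing = isCommutativeRing }

  open CommutativeRing commutativeRing public
    using ( +-identityˡ; +-identityʳ; -‿inverseʳ
          ; *-assoc; *-comm; *-identityˡ; *-identityʳ; distribˡ; distribʳ; zeroˡ; zeroʳ)
  open CommutativeRing commutativeRing
    using (ring; +-abelianGroup; +-commutativeSemigroup; *-commutativeSemigroup)
  open import Algebra.Properties.Ring ring public
    using (-1*x≈-x; x+x≈x⇒x≈0; [y-z]x≈yx-zx)
  open import Algebra.Properties.AbelianGroup +-abelianGroup public
    using (inverseʳ-unique; x∙y⁻¹≈ε⇒x≈y; ∙-cancelˡ)
  open import Algebra.Properties.CommutativeSemigroup +-commutativeSemigroup public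
    using (interchange)
  open import Algebra.Properties.CommutativeSemigroup *-commutativeSemigroup public
    using () renaming (x∙yz≈y∙xz to x*yz≡y*xz)

  x+u≡y+v⇒x-y≡v-u : ∀ {x y u v} → x +F u ≡ y +F v → x +F -F y ≡ v +F -F u
  x+u≡y+v⇒x-y≡v-u {x} {y} {u} {v} eq = begin
    x +F -F y                     ≡⟨ sym (+-identityʳ _) ⟩
    (x +F -F y) +F 0F             ≡⟨ cong ((x +F -F y) +F_) (sym (-‿inverseʳ u)) ⟩
    (x +F -F y) +F (u +F -F u)    ≡⟨ interchange x (-F y) u (-F u) ⟩
    (x +F u) +F (-F y +F -F u)    ≡⟨ cong (_+F (-F y +F -F u)) eq ⟩
    (y +F v) +F (-F y +F -F u)    ≡⟨ interchange y v (-F y) (-F u) ⟩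
    (y +F -F y) +F (v +F -F u)    ≡⟨ cong (_+F (v +F -F u)) (-‿inverseʳ y) ⟩
    0F +F (v +F -F u)             ≡⟨ +-identityˡ _ ⟩
    v +F -F u                     ∎

  trivial-kernel⇒injective : ∀ {B : Set} {_∙_ : B → B → B} (h : Carrier → B) →
                             (∀ u v → h (u +F v) ≡ h u ∙ h v) →
                             (∀ u → h u ≡ h 0F → u ≡ 0F) → Injective _≡_ _≡_ h
  trivial-kernel⇒injective {_∙_ = _∙_} h h-+ kernel {u} {v} hu≡hv =
    x∙y⁻¹≈ε⇒x≈y u v (kernel (u +F -F v) (begin
      h (u +F -F v)     ≡⟨ h-+ u (-F v) ⟩
      h u ∙ h (-F v)    ≡⟨ cong (_∙ h (-F v)) hu≡hv ⟩
      h v ∙ h (-F v)    ≡⟨ h-+ v (-F v) ⟨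
      h (v +F -F v)     ≡⟨ cong h (-‿inverseʳ v) ⟩
      h 0F              ∎))

  pow-+ : ∀ y i j → pow y (i + j) ≡ pow y i *F pow y j
  pow-+ y zero    j = sym (*-identityˡ (pow y j))
  pow-+ y (suc i) j = trans (cong (y *F_) (pow-+ y i j)) (sym (*-assoc y (pow y i) (pow y j)))

  xy≡1⇒[zy]x≡z : ∀ {x y} → x *F y ≡ 1F → ∀ z → (z *F y) *F x ≡ z
  xy≡1⇒[zy]x≡z {x} {y} xy≡1 z = begin
    (z *F y) *F x   ≡⟨ *-assoc z y x ⟩
    z *F (y *F x)   ≡⟨ cong (z *F_) (trans (*-comm y x) xy≡1) ⟩
    z *F 1F         ≡⟨ *-identityʳ z ⟩
    z               ∎

  xy≡1⇒z≢0⇒zy≢0 : ∀ {x y z} → x *F y ≡ 1F → z ≢ 0F → z *F y ≢ 0F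
  xy≡1⇒z≢0⇒zy≢0 {x} {y} {z} xy≡1 z≢0 zy≡0 = z≢0 (begin
    z               ≡⟨ xy≡1⇒[zy]x≡z xy≡1 z ⟨
    (z *F y) *F x   ≡⟨ cong (_*F x) zy≡0 ⟩
    0F *F x         ≡⟨ zeroˡ x ⟩
    0F              ∎)

  orbit-covers : ∀ {α γ} → IsPrimitive F α → γ ≢ 0F →
                 ∀ e → e ≢ 0F → ∃ λ k → pow α k *F γ ≡ e
  orbit-covers {γ = γ} (_ , generates) γ≢0 e e≢0
    with γ⁻¹ , γγ⁻¹≡1 ← inverse γ γ≢0
    with k , αᵏ≡eγ⁻¹ ← generates (e *F γ⁻¹) (xy≡1⇒z≢0⇒zy≢0 γγ⁻¹≡1 e≢0)
    = k , trans (cong (_*F γ) αᵏ≡eγ⁻¹) (xy≡1⇒[zy]x≡z γγ⁻¹≡1 e)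

  sumF-cong : ∀ n {f g : Fin n → Carrier} → f ≗ g → sumF n f ≡ sumF n g
  sumF-cong zero    f≗g = refl
  sumF-cong (suc n) f≗g = cong₂ _+F_ (f≗g zero) (sumF-cong n (f≗g ∘ suc))

  sumF-0 : ∀ n {f : Fin n → Carrier} → (∀ i → f i ≡ 0F) → sumF n f ≡ 0F
  sumF-0 zero    f≡0 = refl
  sumF-0 (suc n) f≡0 = trans (cong₂ _+F_ (f≡0 zero) (sumF-0 n (f≡0 ∘ suc))) (+-identityʳ 0F)

  sumF-+ : ∀ n (f g : Fin n → Carrier) → sumF n (λ i → f i +F g i) ≡ sumF n f +F sumF n g
  sumF-+ zero    f g = sym (+-identityʳ 0F)
  sumF-+ (suc n) f g = trans (cong (f zero +F g zero +F_) (sumF-+ n (f ∘ suc) (g ∘ suc)))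
                             (interchange (f zero) (g zero) _ _)

  sumF-*ˡ : ∀ n a (f : Fin n → Carrier) → a *F sumF n f ≡ sumF n (λ i → a *F f i)
  sumF-*ˡ zero    a f = zeroʳ a
  sumF-*ˡ (suc n) a f = trans (distribˡ a _ _) (cong (a *F f zero +F_) (sumF-*ˡ n a (f ∘ suc)))

  dot-nondegenerate : ∀ {m} (x : Vec Carrier m) →
                      (∀ c → sumF m (λ j → lookup x j *F c j) ≡ 0F) → x ≡ replicate m 0F
  dot-nondegenerate []      _ = refl
  dot-nondegenerate {suc m} (a ∷ x) orthogonal = cong₂ _∷_ a≡0 (dot-nondegenerate x x-orthogonal)
    where
    a≡0 : a ≡ 0F
    a≡0 = begin
      a                                                        ≡⟨ *-identityʳ a ⟨
      a *F 1F                                                  ≡⟨ +-identityʳ _ ⟨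
      a *F 1F +F 0F                                            ≡⟨ cong (a *F 1F +F_) (sumF-0 m (zeroʳ ∘ lookup x)) ⟨
      a *F 1F +F sumF m (λ j → lookup x j *F 0F)               ≡⟨ orthogonal (1F Vector.∷ λ _ → 0F) ⟩
      0F                                                       ∎

    x-orthogonal : ∀ c → sumF m (λ j → lookup x j *F c j) ≡ 0F
    x-orthogonal c = begin
      sumF m (λ j → lookup x j *F c j)                         ≡⟨ +-identityˡ _ ⟨
      0F +F sumF m (λ j → lookup x j *F c j)                   ≡⟨ cong (_+F sumF m (λ j → lookup x j *F c j)) (zeroʳ a) ⟨
      a *F 0F +F sumF m (λ j → lookup x j *F c j)              ≡⟨ orthogonal (0F Vector.∷ c) ⟩
      0F                                                       ∎

module AdditiveMap (F G : Field) (h : Field.Carrier F → Field.Carrier G)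
                   (h-+ : ∀ a b → h (Field._+F_ F a b) ≡ Field._+F_ G (h a) (h b)) where

  private
    module F = FieldProperties F
    module G = FieldProperties G

  h-0 : h F.0F ≡ G.0F
  h-0 = G.x+x≈x⇒x≈0 (h F.0F) (trans (sym (h-+ F.0F F.0F)) (cong h (F.+-identityʳ F.0F)))

  h-neg : ∀ a → h (F.-F a) ≡ G.-F (h a)
  h-neg a = G.inverseʳ-unique (h a) (h (F.-F a))
    (trans (sym (h-+ a (F.-F a))) (trans (cong h (F.-‿inverseʳ a)) h-0))

module ExtensionProperties {K L : Field} (E : Extension K L) where

  private
    module K = FieldProperties K
    module L = FieldProperties L
  open ≡-Reasoning

  open Extension E public
  open AdditiveMap K L ι ι-+ public renaming (h-0 to ι-0; h-neg to ι-neg)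

  ι-inverse-cancel : ∀ {s t} → s K.*F t ≡ K.1F → ∀ δ → ι t L.*F (ι s L.*F δ) ≡ δ
  ι-inverse-cancel {s} {t} st≡1 δ = begin
    ι t L.*F (ι s L.*F δ)   ≡⟨ L.*-assoc (ι t) (ι s) δ ⟨
    (ι t L.*F ι s) L.*F δ   ≡⟨ cong (L._*F δ) (ι-* t s) ⟨
    ι (t K.*F s) L.*F δ     ≡⟨ cong (λ r → ι r L.*F δ) (trans (K.*-comm t s) st≡1) ⟩
    ι K.1F L.*F δ           ≡⟨ cong (L._*F δ) ι-1 ⟩
    L.1F L.*F δ             ≡⟨ L.*-identityˡ δ ⟩
    δ                       ∎

  ι[-1]*≡- : ∀ δ → ι (K.-F K.1F) L.*F δ ≡ L.-F δ
  ι[-1]*≡- δ = trans (cong (L._*F δ) (trans (ι-neg K.1F) (cong L.-F_ ι-1))) (L.-1*x≈-x δ)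

  module _ {n : ℕ} (v : Fin n → L.Carrier) where

    linComb-cong : ∀ {c d} → c ≗ d → linComb E n v c ≡ linComb E n v d
    linComb-cong c≗d = L.sumF-cong n (λ i → cong (λ a → ι a L.*F v i) (c≗d i))

    linComb-+ : ∀ c d → linComb E n v (λ i → c i K.+F d i) ≡ linComb E n v c L.+F linComb E n v d
    linComb-+ c d = trans (L.sumF-cong n (λ i → trans (cong (L._*F v i) (ι-+ (c i) (d i))) (L.distribʳ (v i) _ _)))
                          (L.sumF-+ n _ _)

    linComb-scale : ∀ a c → linComb E n v (λ i → a K.*F c i) ≡ ι a L.*F linComb E n v c
    linComb-scale a c = trans (L.sumF-cong n (λ i → trans (cong (L._*F v i) (ι-* a (c i))) (L.*-assoc _ _ _)))
                              (sym (L.sumF-*ˡ n (ι a) _))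

module Coordinates {K L : Field} (E : Extension K L) {n : ℕ} {b : Fin n → Field.Carrier L}
                   (B : IsBasis E n b) where

  private
    module K = FieldProperties K
    module L = FieldProperties L
  open ExtensionProperties E

  linComb-coords : ∀ γ → linComb E n b (coords E n b B γ) ≡ γ
  linComb-coords γ = proj₂ (proj₂ B γ) refl

  coords-linComb : ∀ c → coords E n b B (linComb E n b c) ≡ c
  coords-linComb c = proj₁ B (linComb-coords (linComb E n b c))

  coords-+ : ∀ u v → coords E n b B (u L.+F v) ≡ (λ i → coords E n b B u i K.+F coords E n b B v i)
  coords-+ u v = proj₁ B (trans (linComb-coords (u L.+F v))
    (sym (trans (linComb-+ b _ _) (cong₂ L._+F_ (linComb-coords u) (linComb-coords v)))))

  coords-scale : ∀ a u → coords E n b B (ι a L.*F u) ≡ (λ i → a K.*F coords E n b B u i)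
  coords-scale a u = proj₁ B (trans (linComb-coords (ι a L.*F u))
    (sym (trans (linComb-scale b a _) (cong (ι a L.*F_) (linComb-coords u)))))

  coordinates : L.Carrier ↔ Vec K.Carrier n
  coordinates = mk↔ₛ′ (tabulate ∘ coords E n b B) (linComb E n b ∘ lookup)
    (λ v → trans (cong tabulate (coords-linComb (lookup v))) (tabulate∘lookup v))
    (λ γ → trans (linComb-cong b (lookup∘tabulate (coords E n b B γ))) (linComb-coords γ))

  functional : Vec K.Carrier n → L.Carrier → K.Carrier
  functional x γ = K.sumF n (λ i → lookup x i K.*F coords E n b B γ i)

  module _ (x : Vec K.Carrier n) where

    functional-+ : ∀ u v → functional x (u L.+F v) ≡ functional x u K.+F functional x v
    functional-+ u v = trans
      (K.sumF-cong n (λ i → trans (cong (λ c → lookup x i K.*F c i) (coords-+ u v)) (K.distribˡ _ _ _)))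
      (K.sumF-+ n _ _)

    functional-scale : ∀ a u → functional x (ι a L.*F u) ≡ a K.*F functional x u
    functional-scale a u = trans
      (K.sumF-cong n (λ i → trans (cong (λ c → lookup x i K.*F c i) (coords-scale a u)) (K.x*yz≡y*xz _ _ _)))
      (sym (K.sumF-*ˡ n a _))

    functional-0 : functional x L.0F ≡ K.0F
    functional-0 = AdditiveMap.h-0 L K (functional x) functional-+

    functional-nondegenerate : (∀ γ → functional x γ ≡ K.0F) → x ≡ replicate n K.0F
    functional-nondegenerate vanishes = K.dot-nondegenerate x (λ c →
      trans (cong (λ d → K.sumF n (λ i → lookup x i K.*F d i)) (sym (coords-linComb c)))
            (vanishes (linComb E n b c)))

module Powers {K L : Field} (E : Extension K L) (α : Field.Carrier L) where

  private
    module K = FieldProperties K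
    module L = FieldProperties L
  open ExtensionProperties E
  open ≡-Reasoning

  -- Leading coefficient first: poly (c₀ ∷ … ∷ cₘ₋₁) = Σᵢ ι cᵢ · α^(m-1-i).
  poly : ∀ {m} → Vec K.Carrier m → L.Carrier
  poly []              = L.0F
  poly {suc m} (a ∷ c) = ι a L.*F L.pow α m L.+F poly c

  Span : ℕ → L.Carrier → Set
  Span m δ = ∃ λ (c : Vec K.Carrier m) → poly c ≡ δ

  MonicRelation : ℕ → Set
  MonicRelation m = Span m (L.pow α m)

  private
    ι0*≡0 : ∀ δ → ι K.0F L.*F δ ≡ L.0F
    ι0*≡0 δ = trans (cong (L._*F δ) ι-0) (L.zeroˡ δ)

  poly-replicate-0 : ∀ m → poly (replicate m K.0F) ≡ L.0F
  poly-replicate-0 zero    = refl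
  poly-replicate-0 (suc m) = trans (cong₂ L._+F_ (ι0*≡0 _) (poly-replicate-0 m)) (L.+-identityˡ L.0F)

  poly-zipWith-+ : ∀ {m} (c d : Vec K.Carrier m) → poly (zipWith K._+F_ c d) ≡ poly c L.+F poly d
  poly-zipWith-+ []      []      = sym (L.+-identityˡ L.0F)
  poly-zipWith-+ {suc m} (a ∷ c) (a′ ∷ d) = begin
    ι (a K.+F a′) L.*F αᵐ L.+F poly (zipWith K._+F_ c d)
      ≡⟨ cong₂ L._+F_ (trans (cong (L._*F αᵐ) (ι-+ a a′)) (L.distribʳ αᵐ _ _)) (poly-zipWith-+ c d) ⟩
    (ι a L.*F αᵐ L.+F ι a′ L.*F αᵐ) L.+F (poly c L.+F poly d)
      ≡⟨ L.interchange _ _ _ _ ⟩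
    (ι a L.*F αᵐ L.+F poly c) L.+F (ι a′ L.*F αᵐ L.+F poly d) ∎
    where αᵐ = L.pow α m

  poly-map-scale : ∀ {m} a (c : Vec K.Carrier m) → poly (map (a K.*F_) c) ≡ ι a L.*F poly c
  poly-map-scale a []      = sym (L.zeroʳ (ι a))
  poly-map-scale {suc m} a (a′ ∷ c) = begin
    ι (a K.*F a′) L.*F αᵐ L.+F poly (map (a K.*F_) c)
      ≡⟨ cong₂ L._+F_ (trans (cong (L._*F αᵐ) (ι-* a a′)) (L.*-assoc _ _ _)) (poly-map-scale a c) ⟩
    ι a L.*F (ι a′ L.*F αᵐ) L.+F ι a L.*F poly c
      ≡⟨ L.distribˡ (ι a) _ _ ⟨
    ι a L.*F (ι a′ L.*F αᵐ L.+F poly c) ∎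
    where αᵐ = L.pow α m

  span-0 : ∀ m → Span m L.0F
  span-0 m = replicate m K.0F , poly-replicate-0 m

  span-+ : ∀ {m u v} → Span m u → Span m v → Span m (u L.+F v)
  span-+ (c , refl) (d , refl) = zipWith K._+F_ c d , poly-zipWith-+ c d

  span-scale : ∀ {m u} a → Span m u → Span m (ι a L.*F u)
  span-scale a (c , refl) = map (a K.*F_) c , poly-map-scale a c

  span-neg : ∀ {m u} → Span m u → Span m (L.-F u)
  span-neg {u = u} s = subst (Span _) (ι[-1]*≡- u) (span-scale (K.-F K.1F) s)

  span-weaken : ∀ {m u} → Span m u → Span (suc m) u
  span-weaken (c , refl) = K.0F ∷ c , trans (cong (L._+F poly c) (ι0*≡0 _)) (L.+-identityˡ (poly c))

  span-top : ∀ m → Span (suc m) (L.pow α m)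
  span-top m = K.1F ∷ replicate m K.0F , (begin
    ι K.1F L.*F L.pow α m L.+F poly (replicate m K.0F)
      ≡⟨ cong₂ L._+F_ (trans (cong (L._*F L.pow α m) ι-1) (L.*-identityˡ _)) (poly-replicate-0 m) ⟩
    L.pow α m L.+F L.0F
      ≡⟨ L.+-identityʳ _ ⟩
    L.pow α m ∎)

  span-pow-< : ∀ {j m} → j < m → Span m (L.pow α j)
  span-pow-< (s≤s j≤m) = span-pow-≤′ (≤⇒≤′ j≤m)
    where
    span-pow-≤′ : ∀ {j m} → j ≤′ m → Span (suc m) (L.pow α j)
    span-pow-≤′ ≤′-refl        = span-top _
    span-pow-≤′ (≤′-step j≤′m) = span-weaken (span-pow-≤′ j≤′m)

  module _ {m : ℕ} (relation : MonicRelation m) where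

    span-pow-≤ : ∀ {j} → j ≤ m → Span m (L.pow α j)
    span-pow-≤ j≤m with m≤n⇒m<n∨m≡n j≤m
    ... | inj₁ j<m  = span-pow-< j<m
    ... | inj₂ refl = relation

    span-α*poly : ∀ {k} (c : Vec K.Carrier k) → k ≤ m → Span m (α L.*F poly c)
    span-α*poly []      _   = subst (Span m) (sym (L.zeroʳ α)) (span-0 m)
    span-α*poly {suc k} (a ∷ c) k<m = subst (Span m) (sym α-distributes)
      (span-+ (span-scale a (span-pow-≤ k<m)) (span-α*poly c (<⇒≤ k<m)))
      where
      α-distributes : α L.*F (ι a L.*F L.pow α k L.+F poly c) ≡ ι a L.*F L.pow α (suc k) L.+F α L.*F poly c
      α-distributes = trans (L.distribˡ α _ _) (cong (L._+F α L.*F poly c) (L.x*yz≡y*xz α (ι a) _))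

    span-pow : ∀ k → Span m (L.pow α k)
    span-pow zero = span-pow-≤ z≤n
    span-pow (suc k) with c , c≡αᵏ ← span-pow k =
      subst (Span m) (cong (α L.*F_) c≡αᵏ) (span-α*poly c ≤-refl)

  module _ (φ : L.Carrier → K.Carrier)
           (φ-+ : ∀ u v → φ (u L.+F v) ≡ φ u K.+F φ v)
           (φ-scale : ∀ a u → φ (ι a L.*F u) ≡ a K.*F φ u)
           {m : ℕ} {γ : L.Carrier}
           (vanishes : ∀ {i} → i < m → φ (L.pow α i L.*F γ) ≡ K.0F) where

    span-annihilated : ∀ {δ} → Span m δ → φ (δ L.*F γ) ≡ K.0F
    span-annihilated (c , refl) = poly-annihilated c ≤-refl
      where
      poly-annihilated : ∀ {k} (c : Vec K.Carrier k) → k ≤ m → φ (poly c L.*F γ) ≡ K.0F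
      poly-annihilated []      _   = trans (cong φ (L.zeroˡ γ)) (AdditiveMap.h-0 L K φ φ-+)
      poly-annihilated {suc k} (a ∷ c) k<m = begin
        φ ((ι a L.*F L.pow α k L.+F poly c) L.*F γ)
          ≡⟨ cong φ (L.distribʳ γ _ _) ⟩
        φ ((ι a L.*F L.pow α k) L.*F γ L.+F poly c L.*F γ)
          ≡⟨ φ-+ _ _ ⟩
        φ ((ι a L.*F L.pow α k) L.*F γ) K.+F φ (poly c L.*F γ)
          ≡⟨ cong₂ K._+F_ (trans (cong φ (L.*-assoc _ _ _)) (φ-scale a _)) (poly-annihilated c (<⇒≤ k<m)) ⟩
        a K.*F φ (L.pow α k L.*F γ) K.+F K.0F
          ≡⟨ cong (λ t → a K.*F t K.+F K.0F) (vanishes k<m) ⟩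
        a K.*F K.0F K.+F K.0F
          ≡⟨ trans (K.+-identityʳ _) (K.zeroʳ a) ⟩
        K.0F ∎

  distinct-leading-coefficients⇒monicRelation :
    ∀ {m a a′ u u′} → a ≢ a′ → Span m u → Span m u′ →
    ι a L.*F L.pow α m L.+F u ≡ ι a′ L.*F L.pow α m L.+F u′ → MonicRelation m
  distinct-leading-coefficients⇒monicRelation {m} {a} {a′} {u} {u′} a≢a′ span-u span-u′ eq
    with t , st≡1 ← K.inverse (a K.+F K.-F a′) (a≢a′ ∘ K.x∙y⁻¹≈ε⇒x≈y a a′)
    = subst (Span m) (ι-inverse-cancel st≡1 (L.pow α m))
        (span-scale t (subst (Span m) (sym scaled) (span-+ span-u′ (span-neg span-u))))
    where
    scaled : ι (a K.+F K.-F a′) L.*F L.pow α m ≡ u′ L.+F L.-F u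
    scaled = begin
      ι (a K.+F K.-F a′) L.*F L.pow α m
        ≡⟨ cong (L._*F L.pow α m) (trans (ι-+ a _) (cong (ι a L.+F_) (ι-neg a′))) ⟩
      (ι a L.+F L.-F ι a′) L.*F L.pow α m
        ≡⟨ L.[y-z]x≈yx-zx _ _ _ ⟩
      ι a L.*F L.pow α m L.+F L.-F (ι a′ L.*F L.pow α m)
        ≡⟨ L.x+u≡y+v⇒x-y≡v-u eq ⟩
      u′ L.+F L.-F u ∎

  poly-collision⇒monicRelation :
    DecidableEquality K.Carrier → ∀ {m} (c c′ : Vec K.Carrier m) → c ≢ c′ →
    poly c ≡ poly c′ → ∃ λ j → j < m × MonicRelation j
  poly-collision⇒monicRelation _≟_ []      []        []≢[]   _  = contradiction refl []≢[]
  poly-collision⇒monicRelation _≟_ (a ∷ c) (a′ ∷ c′) ac≢a′c′ eq with a ≟ a′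
  ... | no a≢a′  = _ , ≤-refl , distinct-leading-coefficients⇒monicRelation a≢a′ (c , refl) (c′ , refl) eq
  ... | yes refl = map₂ (map₁ m<n⇒m<1+n)
                     (poly-collision⇒monicRelation _≟_ c c′ (ac≢a′c′ ∘ cong (a ∷_)) (L.∙-cancelˡ _ _ _ eq))

  -- Pigeonhole: Vec K (n + 1) has q^(n+1) elements but L only q^n, so poly has a collision.
  monicRelation≤dimension : ∀ {q n} {b : Fin n → L.Carrier} → K.Carrier ↔ Fin q → IsBasis E n b →
                            ∃ λ m → m ≤ n × MonicRelation m
  monicRelation≤dimension {q} {n} K↔Fin B
    with c , c′ , c≢c′ , same ← ↔Fin-pigeonhole (vec↔fin^ K↔Fin (suc n))
                                 (↔-trans (Coordinates.coordinates E B) (vec↔fin^ K↔Fin n))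
                                 (^-monoʳ-< q (↔Fin-distinct⇒1< K↔Fin K.0≢1) (n<1+n n)) poly
    = map₂ (map₁ s≤s⁻¹) (poly-collision⇒monicRelation (↔Fin⇒≟ K↔Fin) c c′ c≢c′ same)

module Isomorphism {K L : Field} {q : ℕ} (K↔Fin : Field.Carrier K ↔ Fin q)
                   (E : Extension K L) {n : ℕ} {b : Fin n → Field.Carrier L} (B : IsBasis E n b)
                   {α : Field.Carrier L} (α-primitive : IsPrimitive L α)
                   (x : Vec (Field.Carrier K) n) where

  private
    module K = FieldProperties K
    module L = FieldProperties L
  open Coordinates E B
  open Powers E α
  open ≡-Reasoning

  L↔Fin : L.Carrier ↔ Fin (q ^ n)
  L↔Fin = ↔-trans coordinates (vec↔fin^ K↔Fin n)

  Ψ : L.Carrier → Vec K.Carrier n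
  Ψ γ = tabulate (λ i → functional x (L.pow α (toℕ i) L.*F γ))

  Ψ-0 : Ψ L.0F ≡ replicate n K.0F
  Ψ-0 = trans (tabulate-cong (λ i → trans (cong (functional x) (L.zeroʳ _)) (functional-0 x)))
              (tabulate-const n K.0F)

  Ψ-pow : ∀ j → Ψ (L.pow α j) ≡ Φ E n b B α x j
  Ψ-pow j = tabulate-cong (λ i → cong (functional x) (trans (L.*-comm _ _) (sym (L.pow-+ α j (toℕ i)))))

  Ψ-+ : ∀ u v → Ψ (u L.+F v) ≡ zipWith K._+F_ (Ψ u) (Ψ v)
  Ψ-+ u v = trans
    (tabulate-cong (λ i → trans (cong (functional x) (L.distribˡ _ u v)) (functional-+ x _ _)))
    (sym (zipWith-tabulate K._+F_ _ _))

  module _ (x≢0 : x ≢ replicate n K.0F) where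

    Ψ-trivial-kernel : ∀ γ → Ψ γ ≡ Ψ L.0F → γ ≡ L.0F
    Ψ-trivial-kernel γ Ψγ≡Ψ0 with ↔Fin⇒≟ L↔Fin γ L.0F
    ... | yes γ≡0 = γ≡0
    ... | no  γ≢0 = contradiction (functional-nondegenerate x vanishes-everywhere) x≢0
      where
      vanishes-on-window : ∀ {i} → i < n → functional x (L.pow α i L.*F γ) ≡ K.0F
      vanishes-on-window {i} i<n = begin
        functional x (L.pow α i L.*F γ)
          ≡⟨ cong (λ k → functional x (L.pow α k L.*F γ)) (toℕ-fromℕ< i<n) ⟨
        functional x (L.pow α (toℕ (fromℕ< i<n)) L.*F γ)
          ≡⟨ lookup∘tabulate _ (fromℕ< i<n) ⟨
        lookup (Ψ γ) (fromℕ< i<n)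
          ≡⟨ cong (λ v → lookup v (fromℕ< i<n)) (trans Ψγ≡Ψ0 Ψ-0) ⟩
        lookup (replicate n K.0F) (fromℕ< i<n)
          ≡⟨ lookup-replicate (fromℕ< i<n) K.0F ⟩
        K.0F ∎

      vanishes-on-orbit : ∀ k → functional x (L.pow α k L.*F γ) ≡ K.0F
      vanishes-on-orbit k with m , m≤n , relation ← monicRelation≤dimension K↔Fin B =
        span-annihilated (functional x) (functional-+ x) (functional-scale x)
          (λ i<m → vanishes-on-window (<-≤-trans i<m m≤n)) (span-pow relation k)

      vanishes-everywhere : ∀ e → functional x e ≡ K.0F
      vanishes-everywhere e with ↔Fin⇒≟ L↔Fin e L.0F
      ... | yes refl = functional-0 x
      ... | no  e≢0 with k , αᵏγ≡e ← L.orbit-covers α-primitive γ≢0 e e≢0 =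
        subst (λ e → functional x e ≡ K.0F) αᵏγ≡e (vanishes-on-orbit k)

    Ψ-injective : Injective _≡_ _≡_ Ψ
    Ψ-injective = L.trivial-kernel⇒injective {_∙_ = zipWith K._+F_} Ψ Ψ-+ Ψ-trivial-kernel

    Ψ-surjective : Surjective _≡_ _≡_ Ψ
    Ψ-surjective = ↔Fin-injective⇒surjective L↔Fin (vec↔fin^ K↔Fin n) Ψ Ψ-injective

mainTheorem2 : (K L : Field) (q : ℕ) → (Field.Carrier K ↔ Fin q)
    → (n : ℕ) → 1 ≤ n → (E : Extension K L)
    → (b : Fin n → Field.Carrier L) (B : IsBasis E n b)
    → (α : Field.Carrier L) → IsPrimitive L α
    → (x : Vec (Field.Carrier K) n) → ¬ (x ≡ replicate n (Field.0F K))
    → Σ (Field.Carrier L → Vec (Field.Carrier K) n) λ Ψ →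
        (Ψ (Field.0F L) ≡ replicate n (Field.0F K))
        × (∀ (j : ℕ) → Ψ (Field.pow L α j) ≡ Φ E n b B α x j)
        × (∀ u v → Ψ (Field._+F_ L u v) ≡ zipWith (Field._+F_ K) (Ψ u) (Ψ v))
        × Bijective _≡_ _≡_ Ψ
mainTheorem2 K L q K↔Fin n _ E b B α α-primitive x x≢0 =
  Ψ , Ψ-0 , Ψ-pow , Ψ-+ , Ψ-injective x≢0 , Ψ-surjective x≢0
  where open Isomorphism K↔Fin E B α-primitive x
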